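{- Let $g(x)\in\mathbb Z[x]$ and $f(x)=x^2-x+1+x^2(x-1)^2g(x)$. Define $f^0(x)=x$, $f^m(x)=f(f^{m-1}(x))$, and for $\ell\ge1$ $$A_\ell(x)=-g(f^{\ell-1}(x))\left(\frac{f^{\ell-1}(x)-1}{\prod_{i=0}^{\ell-2}f^i(x)}\right)^2,\qquad B_\ell(x)=-\prod_{i=0}^{\ell-1}f^i(x)^2$$ (empty products equal $1$; so $A_1(x)=-g(x)(x-1)^2$ and $B_1(x)=-x^2$). Then for every $\ell\ge1$, in $\mathbb Q(x)$, $$\sum_{n=0}^{\ell}\frac1{f^n(x)}=[0,x,A_1(x)-1,B_1(x),A_2(x),B_2(x),\dots,A_\ell(x),B_\ell(x)].$$
   Context: $[b_0,\dots,b_m]=b_0+\cfrac{1}{b_1+\cfrac{1}{\ddots+\cfrac1{b_m}}}$. (The $A_\ell(x),B_\ell(x)$ are polynomials in $\mathbb Z[x]$.) -}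

module Defs where

open import Data.Nat using (ℕ; zero; suc)
open import Data.Integer using (ℤ; 0ℤ; 1ℤ; -1ℤ) renaming (_+_ to _+ℤ_; _*_ to _*ℤ_; -_ to -ℤ_)
import Data.Integer as ℤ
open import Data.List using (List; []; _∷_; map; _++_)
open import Data.List.Relation.Unary.All using (All; all?)
open import Data.Product using (_×_; _,_; proj₁; proj₂)
open import Data.Maybe using (Maybe; just; nothing; _>>=_)
open import Data.Bool using (Bool; if_then_else_)
open import Relation.Binary.PropositionalEquality using (_≡_)
open import Relation.Nullary.Decidable using (Dec; ⌊_⌋)

-- ℤ[x]: polynomials as coefficient lists, lowest degree first.
-- (Trailing zeros allowed; equality is "difference has all coefficients 0".)

Poly : Set
Poly = List ℤ

infixl 6 _+P_ _-P_
infixl 7 _*P_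

_+P_ : Poly → Poly → Poly
[] +P q = q
(a ∷ p) +P [] = a ∷ p
(a ∷ p) +P (b ∷ q) = (a +ℤ b) ∷ (p +P q)

scaleP : ℤ → Poly → Poly
scaleP a = map (a *ℤ_)

_*P_ : Poly → Poly → Poly
[] *P q = []
(a ∷ p) *P q = scaleP a q +P (0ℤ ∷ (p *P q))

negP : Poly → Poly
negP = map -ℤ_

_-P_ : Poly → Poly → Poly
p -P q = p +P negP q

constP : ℤ → Poly
constP a = a ∷ []

oneP : Poly
oneP = constP 1ℤ

zeroP : Poly
zeroP = []

X : Poly
X = 0ℤ ∷ 1ℤ ∷ []

sq : Poly → Poly
sq p = p *P p

compose : Poly → Poly → Poly
compose [] q = []
compose (a ∷ p) q = constP a +P (q *P compose p q)

IsZeroP : Poly → Set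
IsZeroP p = All (_≡ 0ℤ) p

isZeroP? : (p : Poly) → Dec (IsZeroP p)
isZeroP? p = all? (ℤ._≟ 0ℤ) p

_≈P_ : Poly → Poly → Set
p ≈P q = IsZeroP (p -P q)

-- ℚ(x) = Frac(ℤ[x]): elements are (numerator , denominator) pairs.
-- A pair is a genuine element of ℚ(x) when its denominator is nonzero.

Frac : Set
Frac = Poly × Poly

num den : Frac → Poly
num = proj₁
den = proj₂

poly : Poly → Frac
poly p = p , oneP

infixl 6 _+F_ _-F_

_+F_ : Frac → Frac → Frac
(a , b) +F (c , d) = (a *P d +P c *P b) , (b *P d)

_-F_ : Frac → Frac → Frac
(a , b) -F (c , d) = (a *P d -P c *P b) , (b *P d)

_≈F_ : Frac → Frac → Set
r ≈F s = (num r *P den s) ≈P (num s *P den r)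

invF : Frac → Maybe Frac
invF (a , b) = if ⌊ isZeroP? a ⌋ then nothing else just (b , a)

defined : Frac → Maybe Frac
defined (a , b) = if ⌊ isZeroP? b ⌋ then nothing else just (a , b)

-- Continued fraction [b₀, …, b_m] = b₀ + 1/(b₁ + 1/(⋯ + 1/b_m)) in ℚ(x);
-- `nothing` when the expression is undefined (empty list, some partial
-- quotient undefined, or division by zero).
contFrac : List Frac → Maybe Frac
contFrac [] = nothing
contFrac (b ∷ []) = defined b
contFrac (b ∷ c ∷ rest) =
  defined b >>= λ b' →
  contFrac (c ∷ rest) >>= λ t →
  invF t >>= λ t⁻¹ →
  just (b' +F t⁻¹)

fPoly : Poly → Poly
fPoly g = (1ℤ ∷ -1ℤ ∷ 1ℤ ∷ []) +P (sq X *P sq (X -P oneP) *P g)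

iterF : Poly → ℕ → Poly
iterF g zero = X
iterF g (suc m) = compose (fPoly g) (iterF g m)

prodIter : Poly → ℕ → Poly
prodIter g zero = oneP
prodIter g (suc k) = prodIter g k *P iterF g k

-- A_ℓ for ℓ = k+1 :  -g(f^k(x)) ((f^k(x) - 1) / ∏_{i=0}^{k-1} f^i(x))²
A : Poly → ℕ → Frac
A g k = negP (compose g (iterF g k) *P sq (iterF g k -P oneP)) , sq (prodIter g k)

-- B_ℓ for ℓ = k+1 :  -∏_{i=0}^{k} f^i(x)²
B : Poly → ℕ → Frac
B g k = poly (negP (sq (prodIter g (suc k))))

-- A_j, B_j for j = 2, …, ℓ (in order)
tailAB : Poly → ℕ → List Frac
tailAB g zero = []
tailAB g (suc zero) = []
tailAB g (suc (suc k)) = tailAB g (suc k) ++ (A g (suc k) ∷ B g (suc k) ∷ [])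

cfEntries : Poly → ℕ → List Frac
cfEntries g ℓ = poly zeroP ∷ poly X ∷ (A g 0 -F poly oneP) ∷ B g 0 ∷ tailAB g ℓ

lhsSum : Poly → ℕ → Frac
lhsSum g zero = oneP , iterF g zero
lhsSum g (suc n) = lhsSum g n +F (oneP , iterF g (suc n))

-- Identities in ℚ(x) are checked at the integers, since a polynomial over ℤ vanishing at every
-- positive integer is zero.  The numerator and denominator of [b₀, …, b_m] form the first column of
-- the product of the matrices (p q; q 0) of its partial quotients b = p/q.  Appending A_{ℓ+1}, B_{ℓ+1}
-- multiplies this product by a matrix depending only on f^ℓ(x) and ∏_{i<ℓ} f^i(x), and up to a scalar
-- the product keeps the columns of the last two convergents, Σ_{n≤ℓ} 1/fⁿ(x) and
-- Σ_{n<ℓ} 1/fⁿ(x) + 1/(f^ℓ(x) − 1).  The continued fraction is well defined because at x = 1 every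
-- fⁱ(1) = 1: the partial quotients become 0, 1, −1, −1, 0, −1, …, 0, −1, whose tails are visibly nonzero.

module Submission where

open import Defs
open import Data.Nat using (ℕ; _≤_; zero; suc; s≤s; z≤n)
import Data.Nat as ℕ
import Data.Nat.Properties as ℕP
open import Data.Integer using (ℤ; +_; 0ℤ; 1ℤ; -1ℤ; _+_; _*_; -_; _-_; ∣_∣)
import Data.Integer.Properties as ℤP
open import Data.Integer.Tactic.RingSolver using (solve-∀; solve)
open import Data.List using (List; []; _∷_; _++_)
import Data.List.Relation.Unary.All as All
open import Data.Product using (Σ; _×_; _,_; ∃; proj₁; proj₂)
open import Data.Sum using (inj₁; inj₂)
open import Data.Maybe using (just)
open import Data.Empty using (⊥-elim)
open import Relation.Nullary using (¬_; yes; no)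
open import Relation.Binary.PropositionalEquality

eval : Poly → ℤ → ℤ
eval [] x = 0ℤ
eval (a ∷ p) x = a + x * eval p x

module _ (x : ℤ) where

  eval-+P : ∀ p q → eval (p +P q) x ≡ eval p x + eval q x
  eval-+P [] q = sym (ℤP.+-identityˡ _)
  eval-+P (a ∷ p) [] = sym (ℤP.+-identityʳ _)
  eval-+P (a ∷ p) (b ∷ q) rewrite eval-+P p q = identity a b x (eval p x) (eval q x)
    where
    identity : ∀ a b x u v → a + b + x * (u + v) ≡ a + x * u + (b + x * v)
    identity = solve-∀

  eval-scaleP : ∀ a q → eval (scaleP a q) x ≡ a * eval q x
  eval-scaleP a [] = sym (ℤP.*-zeroʳ a)
  eval-scaleP a (b ∷ q) rewrite eval-scaleP a q = identity a b x (eval q x)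
    where
    identity : ∀ a b x u → a * b + x * (a * u) ≡ a * (b + x * u)
    identity = solve-∀

  eval-*P : ∀ p q → eval (p *P q) x ≡ eval p x * eval q x
  eval-*P [] q = refl
  eval-*P (a ∷ p) q
    rewrite eval-+P (scaleP a q) (0ℤ ∷ p *P q) | eval-scaleP a q | eval-*P p q
    = identity a x (eval p x) (eval q x)
    where
    identity : ∀ a x u v → a * v + (0ℤ + x * (u * v)) ≡ (a + x * u) * v
    identity = solve-∀

  eval-negP : ∀ p → eval (negP p) x ≡ - eval p x
  eval-negP [] = refl
  eval-negP (a ∷ p) rewrite eval-negP p = identity a x (eval p x)
    where
    identity : ∀ a x u → - a + x * - u ≡ - (a + x * u)
    identity = solve-∀

  eval--P : ∀ p q → eval (p -P q) x ≡ eval p x - eval q x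
  eval--P p q = trans (eval-+P p (negP q)) (cong (λ e → eval p x + e) (eval-negP q))

  eval-constP : ∀ a → eval (constP a) x ≡ a
  eval-constP a = trans (cong (λ e → a + e) (ℤP.*-zeroʳ x)) (ℤP.+-identityʳ a)

  eval-oneP : eval oneP x ≡ 1ℤ
  eval-oneP = eval-constP 1ℤ

  eval-X : eval X x ≡ x
  eval-X = identity x
    where
    identity : ∀ x → 0ℤ + x * (1ℤ + x * 0ℤ) ≡ x
    identity = solve-∀

  eval-sq : ∀ p → eval (sq p) x ≡ eval p x * eval p x
  eval-sq p = eval-*P p p

  eval-compose : ∀ p q → eval (compose p q) x ≡ eval p (eval q x)
  eval-compose [] q = refl
  eval-compose (a ∷ p) q
    rewrite eval-+P (constP a) (q *P compose p q) | eval-constP a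
          | eval-*P q (compose p q) | eval-compose p q
    = refl

  eval-isZeroP : ∀ {p} → IsZeroP p → eval p x ≡ 0ℤ
  eval-isZeroP All.[] = refl
  eval-isZeroP (refl All.∷ z) rewrite eval-isZeroP z = cong (λ e → 0ℤ + e) (ℤP.*-zeroʳ x)

  eval≢0⇒¬IsZeroP : ∀ p → eval p x ≢ 0ℤ → ¬ IsZeroP p
  eval≢0⇒¬IsZeroP p ne z = ne (eval-isZeroP z)

-- |a| = |y| |v| with |y| > |a| forces v = 0.
const+multiple≡0⇒const≡0 : ∀ a v → a + (+ suc ∣ a ∣) * v ≡ 0ℤ → a ≡ 0ℤ
const+multiple≡0⇒const≡0 a v eq = ℤP.∣i∣≡0⇒i≡0 (∣a∣≡0 ∣ v ∣ ∣a∣≡y∣v∣)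
  where
  y = + suc ∣ a ∣
  a≡-yv : a ≡ - (y * v)
  a≡-yv = trans (identity a (y * v)) (trans (cong (λ e → e - y * v) eq) (ℤP.+-identityˡ _))
    where
    identity : ∀ a w → a ≡ a + w - w
    identity = solve-∀
  ∣a∣≡y∣v∣ : ∣ a ∣ ≡ suc ∣ a ∣ ℕ.* ∣ v ∣
  ∣a∣≡y∣v∣ = trans (cong ∣_∣ a≡-yv) (trans (ℤP.∣-i∣≡∣i∣ (y * v)) (ℤP.∣i*j∣≡∣i∣*∣j∣ y v))
  ∣a∣≡0 : ∀ m → ∣ a ∣ ≡ suc ∣ a ∣ ℕ.* m → ∣ a ∣ ≡ 0
  ∣a∣≡0 zero e = trans e (ℕP.*-zeroʳ (suc ∣ a ∣))
  ∣a∣≡0 (suc m) e = ⊥-elim (ℕP.<-irrefl refl (subst (suc ∣ a ∣ ℕ.≤_) (sym e) (ℕP.m≤m*n (suc ∣ a ∣) (suc m))))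

vanishing⇒IsZeroP : ∀ p → (∀ n → eval p (+ suc n) ≡ 0ℤ) → IsZeroP p
vanishing⇒IsZeroP [] _ = All.[]
vanishing⇒IsZeroP (a ∷ p) vanishes = a≡0 All.∷ vanishing⇒IsZeroP p p-vanishes
  where
  a≡0 : a ≡ 0ℤ
  a≡0 = const+multiple≡0⇒const≡0 a (eval p (+ suc ∣ a ∣)) (vanishes ∣ a ∣)
  p-vanishes : ∀ n → eval p (+ suc n) ≡ 0ℤ
  p-vanishes n with ℤP.i*j≡0⇒i≡0∨j≡0 (+ suc n) {eval p (+ suc n)} multiple≡0
    where
    multiple≡0 : + suc n * eval p (+ suc n) ≡ 0ℤ
    multiple≡0 = trans (sym (ℤP.+-identityˡ _))
                       (subst (λ b → b + + suc n * eval p (+ suc n) ≡ 0ℤ) a≡0 (vanishes n))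
  ... | inj₂ e = e

infixl 7 _⊗_

data Mat : Set where
  mk : (a b c d : ℤ) → Mat

m11 m12 m21 m22 : Mat → ℤ
m11 (mk a _ _ _) = a
m12 (mk _ b _ _) = b
m21 (mk _ _ c _) = c
m22 (mk _ _ _ d) = d

_⊗_ : Mat → Mat → Mat
mk a b c d ⊗ mk e f g h = mk (a * e + b * g) (a * f + b * h) (c * e + d * g) (c * f + d * h)

_·_ : ℤ → Mat → Mat
s · mk a b c d = mk (s * a) (s * b) (s * c) (s * d)

I : Mat
I = mk 1ℤ 0ℤ 0ℤ 1ℤ

diag : ℤ → Mat
diag d = mk 1ℤ 0ℤ 0ℤ d

mk-cong : ∀ {a b c d a' b' c' d'} → a ≡ a' → b ≡ b' → c ≡ c' → d ≡ d' → mk a b c d ≡ mk a' b' c' d'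
mk-cong refl refl refl refl = refl

Mat-ext : ∀ {M N} → m11 M ≡ m11 N → m12 M ≡ m12 N → m21 M ≡ m21 N → m22 M ≡ m22 N → M ≡ N
Mat-ext {mk _ _ _ _} {mk _ _ _ _} = mk-cong

⊗-assoc : ∀ L M N → (L ⊗ M) ⊗ N ≡ L ⊗ (M ⊗ N)
⊗-assoc L M N = Mat-ext (e11 L M N) (e12 L M N) (e21 L M N) (e22 L M N)
  where
  row-assoc : ∀ a b e f g h i k →
    (a * e + b * g) * i + (a * f + b * h) * k ≡ a * (e * i + f * k) + b * (g * i + h * k)
  row-assoc = solve-∀
  e11 : ∀ L M N → m11 ((L ⊗ M) ⊗ N) ≡ m11 (L ⊗ (M ⊗ N))
  e11 (mk a b _ _) (mk e f g h) (mk i _ k _) = row-assoc a b e f g h i k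
  e12 : ∀ L M N → m12 ((L ⊗ M) ⊗ N) ≡ m12 (L ⊗ (M ⊗ N))
  e12 (mk a b _ _) (mk e f g h) (mk _ j _ l) = row-assoc a b e f g h j l
  e21 : ∀ L M N → m21 ((L ⊗ M) ⊗ N) ≡ m21 (L ⊗ (M ⊗ N))
  e21 (mk _ _ c d) (mk e f g h) (mk i _ k _) = row-assoc c d e f g h i k
  e22 : ∀ L M N → m22 ((L ⊗ M) ⊗ N) ≡ m22 (L ⊗ (M ⊗ N))
  e22 (mk _ _ c d) (mk e f g h) (mk _ j _ l) = row-assoc c d e f g h j l

⊗-identityˡ : ∀ M → I ⊗ M ≡ M
⊗-identityˡ (mk a b c d) =
  mk-cong (solve (a ∷ c ∷ [])) (solve (b ∷ d ∷ [])) (solve (a ∷ c ∷ [])) (solve (b ∷ d ∷ []))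

·-⊗ : ∀ s M N → (s · M) ⊗ N ≡ s · (M ⊗ N)
·-⊗ s (mk a b c d) (mk e f g h) =
  mk-cong (solve (s ∷ a ∷ b ∷ e ∷ g ∷ [])) (solve (s ∷ a ∷ b ∷ f ∷ h ∷ []))
          (solve (s ∷ c ∷ d ∷ e ∷ g ∷ [])) (solve (s ∷ c ∷ d ∷ f ∷ h ∷ []))

·-· : ∀ s t M → s · (t · M) ≡ (s * t) · M
·-· s t (mk a b c d) =
  mk-cong (sym (ℤP.*-assoc s t a)) (sym (ℤP.*-assoc s t b)) (sym (ℤP.*-assoc s t c)) (sym (ℤP.*-assoc s t d))

m11-⊗diag : ∀ M d → m11 (M ⊗ diag d) ≡ m11 M
m11-⊗diag (mk a b _ _) d = first-column a b
  where
  first-column : ∀ a b → a * 1ℤ + b * 0ℤ ≡ a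
  first-column = solve-∀

m21-⊗diag : ∀ M d → m21 (M ⊗ diag d) ≡ m21 M
m21-⊗diag (mk _ _ c e) d = first-column c e
  where
  first-column : ∀ c e → c * 1ℤ + e * 0ℤ ≡ c
  first-column = solve-∀

cfPair : Frac → List Frac → Frac
cfPair b [] = b
cfPair b (c ∷ rest) = b +F (den t , num t)
  where t = cfPair c rest

CFDefined : Frac → List Frac → Set
CFDefined b [] = ¬ IsZeroP (den b)
CFDefined b (c ∷ rest) = ¬ IsZeroP (den b) × ¬ IsZeroP (num (cfPair c rest)) × CFDefined c rest

defined-nonzero : ∀ b → ¬ IsZeroP (den b) → defined b ≡ just b
defined-nonzero b den≢0 with isZeroP? (den b)
... | yes z = ⊥-elim (den≢0 z)
... | no _ = refl

invF-nonzero : ∀ t → ¬ IsZeroP (num t) → invF t ≡ just (den t , num t)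
invF-nonzero t num≢0 with isZeroP? (num t)
... | yes z = ⊥-elim (num≢0 z)
... | no _ = refl

contFrac-defined : ∀ b rest → CFDefined b rest → contFrac (b ∷ rest) ≡ just (cfPair b rest)
contFrac-defined b [] den≢0 = defined-nonzero b den≢0
contFrac-defined b (c ∷ rest) (den≢0 , num≢0 , tail)
  rewrite defined-nonzero b den≢0 | contFrac-defined c rest tail
        | invF-nonzero (cfPair c rest) num≢0
  = refl

-- The partial quotient p/q contributes the matrix (p q; q 0) = q (p/q 1; 1 0).
pqMat : Frac → ℤ → Mat
pqMat t x = mk (eval (num t) x) (eval (den t) x) (eval (den t) x) 0ℤ

cfMat : List Frac → ℤ → Mat
cfMat [] x = I
cfMat (b ∷ bs) x = pqMat b x ⊗ cfMat bs x

cfMat-++ : ∀ bs cs x → cfMat (bs ++ cs) x ≡ cfMat bs x ⊗ cfMat cs x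
cfMat-++ [] cs x = sym (⊗-identityˡ (cfMat cs x))
cfMat-++ (b ∷ bs) cs x rewrite cfMat-++ bs cs x = sym (⊗-assoc (pqMat b x) (cfMat bs x) (cfMat cs x))

pqMat-eval : ∀ t x {p q} → eval (num t) x ≡ p → eval (den t) x ≡ q → pqMat t x ≡ mk p q q 0ℤ
pqMat-eval t x refl refl = refl

pqMat-minus-one : ∀ r x {p q} → pqMat r x ≡ mk p q q 0ℤ → pqMat (r -F poly oneP) x ≡ mk (p - q) q q 0ℤ
pqMat-minus-one r x {p} {q} pq≡ = pqMat-eval (r -F poly oneP) x num-eq den-eq
  where
  eval-num = cong m11 pq≡
  eval-den = cong m12 pq≡
  num-eq : eval (num r *P oneP -P oneP *P den r) x ≡ p - q
  num-eq = begin
    eval (num r *P oneP -P oneP *P den r) x           ≡⟨ eval--P x (num r *P oneP) (oneP *P den r) ⟩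
    eval (num r *P oneP) x - eval (oneP *P den r) x   ≡⟨ cong₂ _-_ (eval-*P x (num r) oneP) (eval-*P x oneP (den r)) ⟩
    eval (num r) x * eval oneP x - eval oneP x * eval (den r) x
      ≡⟨ cong₂ (λ u v → eval (num r) x * u - u * v) (eval-oneP x) eval-den ⟩
    eval (num r) x * 1ℤ - 1ℤ * q                      ≡⟨ cong₂ _-_ (trans (ℤP.*-identityʳ _) eval-num) (ℤP.*-identityˡ q) ⟩
    p - q                                             ∎
    where open ≡-Reasoning
  den-eq : eval (den r *P oneP) x ≡ q
  den-eq = trans (eval-*P x (den r) oneP) (trans (cong₂ _*_ eval-den (eval-oneP x)) (ℤP.*-identityʳ q))

FirstColumn : Frac → ℤ → Mat → Set
FirstColumn t x M = eval (num t) x ≡ m11 M × eval (den t) x ≡ m21 M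

firstColumn-cons : ∀ b t x M → FirstColumn t x M → FirstColumn (b +F (den t , num t)) x (pqMat b x ⊗ M)
firstColumn-cons b t x (mk u _ v _) (num≡ , den≡) = num-eq , den-eq
  where
  num-eq : eval (num b *P num t +P den t *P den b) x ≡ eval (num b) x * u + eval (den b) x * v
  num-eq rewrite eval-+P x (num b *P num t) (den t *P den b) | eval-*P x (num b) (num t)
               | eval-*P x (den t) (den b) | num≡ | den≡
    = cong (λ e → eval (num b) x * u + e) (ℤP.*-comm v (eval (den b) x))
  den-eq : eval (den b *P num t) x ≡ eval (den b) x * u + 0ℤ * v
  den-eq rewrite eval-*P x (den b) (num t) | num≡ = sym (ℤP.+-identityʳ _)

firstColumn-cfPair : ∀ b rest x → FirstColumn (cfPair b rest) x (cfMat (b ∷ rest) x)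
firstColumn-cfPair b [] x = sym (m11-⊗diag (pqMat b x) 1ℤ) , sym (m21-⊗diag (pqMat b x) 1ℤ)
firstColumn-cfPair b (c ∷ rest) x =
  firstColumn-cons b (cfPair c rest) x (cfMat (c ∷ rest) x) (firstColumn-cfPair c rest x)

CFNonzeroAt : ℤ → Frac → List Frac → Set
CFNonzeroAt x b [] = eval (den b) x ≢ 0ℤ
CFNonzeroAt x b (c ∷ rest) = eval (den b) x ≢ 0ℤ × m11 (cfMat (c ∷ rest) x) ≢ 0ℤ × CFNonzeroAt x c rest

cfNonzeroAt⇒CFDefined : ∀ x b rest → CFNonzeroAt x b rest → CFDefined b rest
cfNonzeroAt⇒CFDefined x b [] den≢0 = eval≢0⇒¬IsZeroP x (den b) den≢0
cfNonzeroAt⇒CFDefined x b (c ∷ rest) (den≢0 , m11≢0 , tail) =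
  eval≢0⇒¬IsZeroP x (den b) den≢0 ,
  eval≢0⇒¬IsZeroP x (num (cfPair c rest)) (λ e → m11≢0 (trans (sym (proj₁ (firstColumn-cfPair c rest x))) e)) ,
  cfNonzeroAt⇒CFDefined x c rest tail

-- For F = f^ℓ(x), P = ∏_{i<ℓ} f^i(x) and N/P = Σ_{n<ℓ} 1/f^n(x), the two columns of sumMat are
-- proportional to Σ_{n≤ℓ} 1/f^n(x) and to Σ_{n<ℓ} 1/f^n(x) + 1/(f^ℓ(x) − 1): the last two convergents.
sumMat : ℤ → ℤ → ℤ → Mat
sumMat F P N = mk (N * F + P) (- ((F - 1ℤ) * N + P)) (P * F) (P * (1ℤ - F))

-- A_{ℓ+1} contributes diag (P²) ⊗ (a P²; 1 0), and its factor diag (P²) is the one carried by the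
-- invariant Q ⊗ diag (P²) ≡ s · sumMat F P N; stepMat is the rest of the contribution of A_{ℓ+1}, B_{ℓ+1}.
stepMat : ℤ → ℤ → ℤ → Mat
stepMat F P G = mk (- (G * ((F - 1ℤ) * (F - 1ℤ)))) (P * P) 1ℤ 0ℤ ⊗ mk (- (P * F * (P * F))) 1ℤ 1ℤ 0ℤ

sumMat-step : ∀ F P N G →
  (sumMat F P N ⊗ stepMat F P G) ⊗ diag (P * F * (P * F))
    ≡ (P * P) · sumMat (F * F - F + 1ℤ + F * F * ((F - 1ℤ) * (F - 1ℤ)) * G) (P * F) (N * F + P)
sumMat-step F P N G = mk-cong (solve (F ∷ P ∷ N ∷ G ∷ [])) (solve (F ∷ P ∷ N ∷ G ∷ []))
                              (solve (F ∷ P ∷ N ∷ G ∷ [])) (solve (F ∷ P ∷ N ∷ G ∷ []))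

sumMat-append : ∀ Q s F P N G → Q ⊗ diag (P * P) ≡ s · sumMat F P N →
  (Q ⊗ (diag (P * P) ⊗ stepMat F P G)) ⊗ diag (P * F * (P * F))
    ≡ (s * (P * P)) · sumMat (F * F - F + 1ℤ + F * F * ((F - 1ℤ) * (F - 1ℤ)) * G) (P * F) (N * F + P)
sumMat-append Q s F P N G invariant = begin
  (Q ⊗ (diag (P * P) ⊗ S)) ⊗ D      ≡⟨ cong (_⊗ D) (sym (⊗-assoc Q (diag (P * P)) S)) ⟩
  ((Q ⊗ diag (P * P)) ⊗ S) ⊗ D      ≡⟨ cong (λ M → (M ⊗ S) ⊗ D) invariant ⟩
  ((s · sumMat F P N) ⊗ S) ⊗ D      ≡⟨ cong (_⊗ D) (·-⊗ s (sumMat F P N) S) ⟩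
  (s · (sumMat F P N ⊗ S)) ⊗ D      ≡⟨ ·-⊗ s (sumMat F P N ⊗ S) D ⟩
  s · ((sumMat F P N ⊗ S) ⊗ D)      ≡⟨ cong (s ·_) (sumMat-step F P N G) ⟩
  s · ((P * P) · sumMat _ (P * F) (N * F + P)) ≡⟨ ·-· s (P * P) _ ⟩
  (s * (P * P)) · sumMat _ (P * F) (N * F + P) ∎
  where
  open ≡-Reasoning
  S = stepMat F P G
  D = diag (P * F * (P * F))

sumMat-cong : ∀ {F F' P P' N N'} → F ≡ F' → P ≡ P' → N ≡ N' → sumMat F P N ≡ sumMat F' P' N'
sumMat-cong refl refl refl = refl

pqMats-AB : ∀ F P G →
  mk (- (G * ((F - 1ℤ) * (F - 1ℤ)))) (P * P) (P * P) 0ℤ ⊗ (mk (- (P * F * (P * F))) 1ℤ 1ℤ 0ℤ ⊗ I)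
    ≡ diag (P * P) ⊗ stepMat F P G
pqMats-AB F P G = mk-cong (solve (F ∷ P ∷ G ∷ [])) (solve (F ∷ P ∷ G ∷ []))
                          (solve (F ∷ P ∷ G ∷ [])) (solve (F ∷ P ∷ G ∷ []))

pqMats-front : ∀ x G →
  (mk 0ℤ 1ℤ 1ℤ 0ℤ ⊗ (mk x 1ℤ 1ℤ 0ℤ ⊗ (mk (- (G * ((x - 1ℤ) * (x - 1ℤ))) - 1ℤ) 1ℤ 1ℤ 0ℤ
    ⊗ (mk (- (x * x)) 1ℤ 1ℤ 0ℤ ⊗ I)))) ⊗ diag (x * x)
    ≡ 1ℤ · sumMat (x * x - x + 1ℤ + x * x * ((x - 1ℤ) * (x - 1ℤ)) * G) x 1ℤ
pqMats-front x G = mk-cong (solve (x ∷ G ∷ [])) (solve (x ∷ G ∷ [])) (solve (x ∷ G ∷ [])) (solve (x ∷ G ∷ []))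

eval-fPoly : ∀ g y → eval (fPoly g) y ≡ y * y - y + 1ℤ + y * y * ((y - 1ℤ) * (y - 1ℤ)) * eval g y
eval-fPoly g y = begin
  eval (x²-x+1 +P sq X *P sq (X -P oneP) *P g) y
    ≡⟨ eval-+P y x²-x+1 (sq X *P sq (X -P oneP) *P g) ⟩
  eval x²-x+1 y + eval (sq X *P sq (X -P oneP) *P g) y
    ≡⟨ cong (λ e → eval x²-x+1 y + e) (eval-*P y (sq X *P sq (X -P oneP)) g) ⟩
  eval x²-x+1 y + eval (sq X *P sq (X -P oneP)) y * eval g y
    ≡⟨ cong (λ e → eval x²-x+1 y + e * eval g y) (eval-*P y (sq X) (sq (X -P oneP))) ⟩
  eval x²-x+1 y + eval (sq X) y * eval (sq (X -P oneP)) y * eval g y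
    ≡⟨ cong₂ (λ u v → eval x²-x+1 y + u * v * eval g y)
             (trans (eval-sq y X) (cong₂ _*_ (eval-X y) (eval-X y)))
             (trans (eval-sq y (X -P oneP)) (cong₂ _*_ eval-x-1 eval-x-1)) ⟩
  eval x²-x+1 y + y * y * ((y - 1ℤ) * (y - 1ℤ)) * eval g y
    ≡⟨ identity y (eval g y) ⟩
  y * y - y + 1ℤ + y * y * ((y - 1ℤ) * (y - 1ℤ)) * eval g y ∎
  where
  open ≡-Reasoning
  x²-x+1 = 1ℤ ∷ -1ℤ ∷ 1ℤ ∷ []
  eval-x-1 : eval (X -P oneP) y ≡ y - 1ℤ
  eval-x-1 = trans (eval--P y X oneP) (cong₂ _-_ (eval-X y) (eval-oneP y))
  identity : ∀ y G → 1ℤ + y * (-1ℤ + y * (1ℤ + y * 0ℤ)) + y * y * ((y - 1ℤ) * (y - 1ℤ)) * G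
                   ≡ y * y - y + 1ℤ + y * y * ((y - 1ℤ) * (y - 1ℤ)) * G
  identity = solve-∀

cfEntriesTail : Poly → ℕ → List Frac
cfEntriesTail g ℓ = poly X ∷ (A g 0 -F poly oneP) ∷ B g 0 ∷ tailAB g ℓ

module Orbit (g : Poly) (x : ℤ) where

  F P N G : ℕ → ℤ
  F n = eval (iterF g n) x
  P n = eval (prodIter g n) x
  N n = eval (num (lhsSum g n)) x
  G n = eval g (F n)

  F-suc : ∀ n → F (suc n) ≡ F n * F n - F n + 1ℤ + F n * F n * ((F n - 1ℤ) * (F n - 1ℤ)) * G n
  F-suc n = trans (eval-compose x (fPoly g) (iterF g n)) (eval-fPoly g (F n))

  P-suc : ∀ n → P (suc n) ≡ P n * F n
  P-suc n = eval-*P x (prodIter g n) (iterF g n)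

  P-one : P 1 ≡ x
  P-one = trans (P-suc 0) (trans (cong₂ _*_ (eval-oneP x) (eval-X x)) (ℤP.*-identityˡ x))

  eval-den-lhsSum : ∀ n → eval (den (lhsSum g n)) x ≡ P (suc n)
  eval-den-lhsSum zero = trans (eval-X x) (sym P-one)
  eval-den-lhsSum (suc n) = begin
    eval (den (lhsSum g n) *P iterF g (suc n)) x ≡⟨ eval-*P x (den (lhsSum g n)) (iterF g (suc n)) ⟩
    eval (den (lhsSum g n)) x * F (suc n)       ≡⟨ cong (_* F (suc n)) (eval-den-lhsSum n) ⟩
    P (suc n) * F (suc n)                       ≡⟨ sym (P-suc (suc n)) ⟩
    P (suc (suc n))                             ∎
    where open ≡-Reasoning

  N-suc : ∀ n → N (suc n) ≡ N n * F (suc n) + P (suc n)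
  N-suc n = begin
    eval (num l *P iterF g (suc n) +P oneP *P den l) x
      ≡⟨ eval-+P x (num l *P iterF g (suc n)) (oneP *P den l) ⟩
    eval (num l *P iterF g (suc n)) x + eval (oneP *P den l) x
      ≡⟨ cong₂ _+_ (eval-*P x (num l) (iterF g (suc n))) (eval-*P x oneP (den l)) ⟩
    N n * F (suc n) + eval oneP x * eval (den l) x
      ≡⟨ cong (λ e → N n * F (suc n) + e) (trans (cong₂ _*_ (eval-oneP x) (eval-den-lhsSum n)) (ℤP.*-identityˡ _)) ⟩
    N n * F (suc n) + P (suc n) ∎
    where
    open ≡-Reasoning
    l = lhsSum g n

  pqMat-A : ∀ n → pqMat (A g n) x ≡ mk (- (G n * ((F n - 1ℤ) * (F n - 1ℤ)))) (P n * P n) (P n * P n) 0ℤ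
  pqMat-A n = pqMat-eval (A g n) x num-eq (eval-sq x (prodIter g n))
    where
    num-eq : eval (num (A g n)) x ≡ - (G n * ((F n - 1ℤ) * (F n - 1ℤ)))
    num-eq rewrite eval-negP x (compose g (iterF g n) *P sq (iterF g n -P oneP))
                 | eval-*P x (compose g (iterF g n)) (sq (iterF g n -P oneP))
                 | eval-compose x g (iterF g n) | eval-sq x (iterF g n -P oneP)
                 | eval--P x (iterF g n) oneP | eval-oneP x
      = refl

  pqMat-B : ∀ n → pqMat (B g n) x ≡ mk (- (P (suc n) * P (suc n))) 1ℤ 1ℤ 0ℤ
  pqMat-B n = pqMat-eval (B g n) x (trans (eval-negP x (sq (prodIter g (suc n)))) (cong -_ (eval-sq x (prodIter g (suc n)))))
                         (eval-oneP x)

  Convergents : ℕ → Set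
  Convergents k = ∃ λ s →
    cfMat (cfEntries g (suc k)) x ⊗ diag (P (suc k) * P (suc k)) ≡ s · sumMat (F (suc k)) (P (suc k)) (N k)

  convergents-one : Convergents 0
  convergents-one = 1ℤ , (begin
    cfMat (cfEntries g 1) x ⊗ diag (P 1 * P 1)      ≡⟨ cong₂ (λ M p → M ⊗ diag (p * p)) entries P-one ⟩
    (mk 0ℤ 1ℤ 1ℤ 0ℤ ⊗ (mk x 1ℤ 1ℤ 0ℤ ⊗ (mk (nA - 1ℤ) 1ℤ 1ℤ 0ℤ ⊗ (mk (- (x * x)) 1ℤ 1ℤ 0ℤ ⊗ I))))
      ⊗ diag (x * x)                                ≡⟨ pqMats-front x (G 0) ⟩
    1ℤ · sumMat (f x) x 1ℤ                           ≡⟨ cong (1ℤ ·_) (sumMat-cong F-one (sym P-one) (sym (eval-oneP x))) ⟩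
    1ℤ · sumMat (F 1) (P 1) (N 0)                    ∎)
    where
    open ≡-Reasoning
    nA = - (G 0 * ((x - 1ℤ) * (x - 1ℤ)))
    f : ℤ → ℤ
    f y = y * y - y + 1ℤ + y * y * ((y - 1ℤ) * (y - 1ℤ)) * G 0
    F-one : f x ≡ F 1
    F-one = sym (trans (F-suc 0) (cong f (eval-X x)))
    entries : cfMat (cfEntries g 1) x
            ≡ mk 0ℤ 1ℤ 1ℤ 0ℤ ⊗ (mk x 1ℤ 1ℤ 0ℤ ⊗ (mk (nA - 1ℤ) 1ℤ 1ℤ 0ℤ ⊗ (mk (- (x * x)) 1ℤ 1ℤ 0ℤ ⊗ I)))
    entries =
      cong₂ _⊗_ (pqMat-eval (poly zeroP) x refl (eval-oneP x))
        (cong₂ _⊗_ (pqMat-eval (poly X) x (eval-X x) (eval-oneP x))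
          (cong₂ _⊗_ (trans (pqMat-minus-one (A g 0) x (pqMat-A 0))
                            (cong₂ (λ y p → mk (- (G 0 * ((y - 1ℤ) * (y - 1ℤ))) - p * p) (p * p) (p * p) 0ℤ)
                                   (eval-X x) (eval-oneP x)))
                     (cong (_⊗ I) (trans (pqMat-B 0) (cong (λ p → mk (- (p * p)) 1ℤ 1ℤ 0ℤ) P-one)))))

  convergents-suc : ∀ k → Convergents k → Convergents (suc k)
  convergents-suc k (s , invariant) = s * (P₁ * P₁) , (begin
    cfMat (cfEntries g (suc (suc k))) x ⊗ diag (P (suc (suc k)) * P (suc (suc k)))
      ≡⟨ cong₂ (λ M p → M ⊗ diag (p * p)) appended (P-suc (suc k)) ⟩
    (Q ⊗ (diag (P₁ * P₁) ⊗ stepMat F₁ P₁ (G (suc k)))) ⊗ diag (P₁ * F₁ * (P₁ * F₁))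
      ≡⟨ sumMat-append Q s F₁ P₁ (N k) (G (suc k)) invariant ⟩
    (s * (P₁ * P₁)) · sumMat _ (P₁ * F₁) (N k * F₁ + P₁)
      ≡⟨ cong ((s * (P₁ * P₁)) ·_) (sumMat-cong (sym (F-suc (suc k))) (sym (P-suc (suc k))) (sym (N-suc k))) ⟩
    (s * (P₁ * P₁)) · sumMat (F (suc (suc k))) (P (suc (suc k))) (N (suc k)) ∎)
    where
    open ≡-Reasoning
    Q = cfMat (cfEntries g (suc k)) x
    F₁ = F (suc k)
    P₁ = P (suc k)
    appended : cfMat (cfEntries g (suc (suc k))) x ≡ Q ⊗ (diag (P₁ * P₁) ⊗ stepMat F₁ P₁ (G (suc k)))
    appended = begin
      cfMat (cfEntries g (suc k) ++ A g (suc k) ∷ B g (suc k) ∷ []) x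
        ≡⟨ cfMat-++ (cfEntries g (suc k)) (A g (suc k) ∷ B g (suc k) ∷ []) x ⟩
      Q ⊗ (pqMat (A g (suc k)) x ⊗ (pqMat (B g (suc k)) x ⊗ I))
        ≡⟨ cong₂ (λ M M' → Q ⊗ (M ⊗ (M' ⊗ I))) (pqMat-A (suc k))
                 (trans (pqMat-B (suc k)) (cong (λ p → mk (- (p * p)) 1ℤ 1ℤ 0ℤ) (P-suc (suc k)))) ⟩
      Q ⊗ (mk (- (G (suc k) * ((F₁ - 1ℤ) * (F₁ - 1ℤ)))) (P₁ * P₁) (P₁ * P₁) 0ℤ
             ⊗ (mk (- (P₁ * F₁ * (P₁ * F₁))) 1ℤ 1ℤ 0ℤ ⊗ I))
        ≡⟨ cong (Q ⊗_) (pqMats-AB F₁ P₁ (G (suc k))) ⟩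
      Q ⊗ (diag (P₁ * P₁) ⊗ stepMat F₁ P₁ (G (suc k))) ∎

  convergents : ∀ k → Convergents k
  convergents zero = convergents-one
  convergents (suc k) = convergents-suc k (convergents k)

  cfEntries-firstColumn : ∀ k → ∃ λ s → m11 (cfMat (cfEntries g (suc k)) x) ≡ s * N (suc k)
                                    × m21 (cfMat (cfEntries g (suc k)) x) ≡ s * P (suc (suc k))
  cfEntries-firstColumn k with convergents k
  ... | s , invariant = s , (begin
      m11 Q                                      ≡⟨ sym (m11-⊗diag Q _) ⟩
      m11 (Q ⊗ diag (P₁ * P₁))                   ≡⟨ cong m11 invariant ⟩
      s * (N k * F (suc k) + P₁)                 ≡⟨ cong (s *_) (sym (N-suc k)) ⟩
      s * N (suc k)                              ∎) , (begin
      m21 Q                                      ≡⟨ sym (m21-⊗diag Q _) ⟩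
      m21 (Q ⊗ diag (P₁ * P₁))                   ≡⟨ cong m21 invariant ⟩
      s * (P₁ * F (suc k))                       ≡⟨ cong (s *_) (sym (P-suc (suc k))) ⟩
      s * P (suc (suc k))                        ∎)
    where
    open ≡-Reasoning
    Q = cfMat (cfEntries g (suc k)) x
    P₁ = P (suc k)

  cross-difference≡0 : ∀ k → let r = cfPair (poly zeroP) (cfEntriesTail g (suc k)) ; l = lhsSum g (suc k) in
                 eval (num r *P den l -P num l *P den r) x ≡ 0ℤ
  cross-difference≡0 k with cfEntries-firstColumn k | firstColumn-cfPair (poly zeroP) (cfEntriesTail g (suc k)) x
  ... | s , m11≡ , m21≡ | num≡ , den≡ = begin
    eval (num r *P den l -P num l *P den r) x           ≡⟨ eval--P x (num r *P den l) (num l *P den r) ⟩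
    eval (num r *P den l) x - eval (num l *P den r) x   ≡⟨ cong₂ _-_ (eval-*P x (num r) (den l)) (eval-*P x (num l) (den r)) ⟩
    eval (num r) x * eval (den l) x - N (suc k) * eval (den r) x
      ≡⟨ cong₂ (λ u v → u * eval (den l) x - N (suc k) * v) (trans num≡ m11≡) (trans den≡ m21≡) ⟩
    s * N (suc k) * eval (den l) x - N (suc k) * (s * P (suc (suc k)))
      ≡⟨ cong (λ u → s * N (suc k) * u - N (suc k) * (s * P (suc (suc k)))) (eval-den-lhsSum (suc k)) ⟩
    s * N (suc k) * P (suc (suc k)) - N (suc k) * (s * P (suc (suc k)))
      ≡⟨ identity s (N (suc k)) (P (suc (suc k))) ⟩
    0ℤ                                                   ∎
    where
    open ≡-Reasoning
    r = cfPair (poly zeroP) (cfEntriesTail g (suc k))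
    l = lhsSum g (suc k)
    identity : ∀ s N P → s * N * P - N * (s * P) ≡ 0ℤ
    identity = solve-∀

-- Nondegeneracy at x = 1

quotMat : ℤ → Mat
quotMat v = mk v 1ℤ 1ℤ 0ℤ

data Alternating : List Frac → Set where
  alt-[] : Alternating []
  alt-∷ : ∀ {a b L} → pqMat a 1ℤ ≡ quotMat 0ℤ → pqMat b 1ℤ ≡ quotMat -1ℤ → Alternating L → Alternating (a ∷ b ∷ L)

alternating-snoc : ∀ {L a b} → Alternating L → pqMat a 1ℤ ≡ quotMat 0ℤ → pqMat b 1ℤ ≡ quotMat -1ℤ →
                   Alternating (L ++ a ∷ b ∷ [])
alternating-snoc alt-[] ea eb = alt-∷ ea eb alt-[]
alternating-snoc (alt-∷ ea' eb' alt) ea eb = alt-∷ ea' eb' (alternating-snoc alt ea eb)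

alternating-cfMat : ∀ {L} → Alternating L → ∃ λ n → cfMat L 1ℤ ≡ mk 1ℤ 0ℤ (- (+ n)) 1ℤ
alternating-cfMat alt-[] = 0 , refl
alternating-cfMat (alt-∷ {a} {b} {L} ea eb alt) with alternating-cfMat alt
... | n , eq = suc n , (begin
  pqMat a 1ℤ ⊗ (pqMat b 1ℤ ⊗ cfMat L 1ℤ)                        ≡⟨ cong₂ (λ M M' → M ⊗ (M' ⊗ cfMat L 1ℤ)) ea eb ⟩
  quotMat 0ℤ ⊗ (quotMat -1ℤ ⊗ cfMat L 1ℤ)                         ≡⟨ cong (λ M → quotMat 0ℤ ⊗ (quotMat -1ℤ ⊗ M)) eq ⟩
  quotMat 0ℤ ⊗ (quotMat -1ℤ ⊗ mk 1ℤ 0ℤ (- (+ n)) 1ℤ)               ≡⟨ identity (+ n) ⟩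
  mk 1ℤ 0ℤ (- (1ℤ + + n)) 1ℤ                                        ∎)
  where
  open ≡-Reasoning
  identity : ∀ m → quotMat 0ℤ ⊗ (quotMat -1ℤ ⊗ mk 1ℤ 0ℤ (- m) 1ℤ) ≡ mk 1ℤ 0ℤ (- (1ℤ + m)) 1ℤ
  identity m = mk-cong (solve (m ∷ [])) (solve (m ∷ [])) (solve (m ∷ [])) (solve (m ∷ []))

pqMat-den≢0 : ∀ b {v} → pqMat b 1ℤ ≡ quotMat v → eval (den b) 1ℤ ≢ 0ℤ
pqMat-den≢0 b eq den≡0 with trans (sym (cong m12 eq)) den≡0
... | ()

minusOne-cfMat : ∀ b {L} → pqMat b 1ℤ ≡ quotMat -1ℤ → Alternating L →
                 ∃ λ n → cfMat (b ∷ L) 1ℤ ≡ mk (- (+ suc n)) 1ℤ 1ℤ 0ℤ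
minusOne-cfMat b {L} eb alt with alternating-cfMat alt
... | n , eq = n , trans (cong₂ _⊗_ eb eq) (identity (+ n))
  where
  identity : ∀ m → quotMat -1ℤ ⊗ mk 1ℤ 0ℤ (- m) 1ℤ ≡ mk (- (1ℤ + m)) 1ℤ 1ℤ 0ℤ
  identity m = mk-cong (solve (m ∷ [])) (solve (m ∷ [])) (solve (m ∷ [])) (solve (m ∷ []))

m11≢0 : ∀ M {a b c d} → M ≡ mk a b c d → a ≢ 0ℤ → m11 M ≢ 0ℤ
m11≢0 M refl a≢0 = a≢0

mutual
  minusOne-nonzero : ∀ b {L} → pqMat b 1ℤ ≡ quotMat -1ℤ → Alternating L → CFNonzeroAt 1ℤ b L
  minusOne-nonzero b eb alt-[] = pqMat-den≢0 b eb
  minusOne-nonzero b {L} eb alt@(alt-∷ _ _ _) =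
    pqMat-den≢0 b eb , m11≢0 (cfMat L 1ℤ) (proj₂ (alternating-cfMat alt)) (λ ()) , alternating-nonzero alt

  alternating-nonzero : ∀ {a b L} → Alternating (a ∷ b ∷ L) → CFNonzeroAt 1ℤ a (b ∷ L)
  alternating-nonzero {a} {b} {L} (alt-∷ ea eb alt) =
    pqMat-den≢0 a ea , m11≢0 (cfMat (b ∷ L) 1ℤ) (proj₂ (minusOne-cfMat b eb alt)) (λ ()) , minusOne-nonzero b eb alt

module AtOne (g : Poly) where
  open Orbit g 1ℤ

  F-at-1 : ∀ n → F n ≡ 1ℤ
  F-at-1 zero = eval-X 1ℤ
  F-at-1 (suc n) = trans (F-suc n) (cong (λ y → y * y - y + 1ℤ + y * y * ((y - 1ℤ) * (y - 1ℤ)) * G n) (F-at-1 n))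

  P-at-1 : ∀ n → P n ≡ 1ℤ
  P-at-1 zero = eval-oneP 1ℤ
  P-at-1 (suc n) = trans (P-suc n) (cong₂ _*_ (P-at-1 n) (F-at-1 n))

  pqMat-A-at-1 : ∀ n → pqMat (A g n) 1ℤ ≡ quotMat 0ℤ
  pqMat-A-at-1 n = begin
    pqMat (A g n) 1ℤ                                       ≡⟨ pqMat-A n ⟩
    mk (- (G n * ((F n - 1ℤ) * (F n - 1ℤ)))) (P n * P n) (P n * P n) 0ℤ
      ≡⟨ cong₂ (λ y p → mk (- (G n * ((y - 1ℤ) * (y - 1ℤ)))) (p * p) (p * p) 0ℤ) (F-at-1 n) (P-at-1 n) ⟩
    mk (- (G n * 0ℤ)) 1ℤ 1ℤ 0ℤ                              ≡⟨ cong (λ e → mk (- e) 1ℤ 1ℤ 0ℤ) (ℤP.*-zeroʳ (G n)) ⟩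
    quotMat 0ℤ                                             ∎
    where open ≡-Reasoning

  pqMat-B-at-1 : ∀ n → pqMat (B g n) 1ℤ ≡ quotMat -1ℤ
  pqMat-B-at-1 n = trans (pqMat-B n) (cong (λ p → mk (- (p * p)) 1ℤ 1ℤ 0ℤ) (P-at-1 (suc n)))

  alternating-tailAB : ∀ k → Alternating (tailAB g k)
  alternating-tailAB zero = alt-[]
  alternating-tailAB (suc zero) = alt-[]
  alternating-tailAB (suc (suc k)) =
    alternating-snoc (alternating-tailAB (suc k)) (pqMat-A-at-1 (suc k)) (pqMat-B-at-1 (suc k))

  cfEntries-nonzero : ∀ ℓ → CFNonzeroAt 1ℤ (poly zeroP) (cfEntriesTail g ℓ)
  cfEntries-nonzero ℓ with minusOne-cfMat (B g 0) (pqMat-B-at-1 0) (alternating-tailAB ℓ)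
  ... | n , eq =
    pqMat-den≢0 (poly zeroP) q0 , m11≢0 (cfMat (c1 ∷ c2 ∷ c3 ∷ T) 1ℤ) eq1 (λ ()) ,
    pqMat-den≢0 c1 q1 , m11≢0 (cfMat (c2 ∷ c3 ∷ T) 1ℤ) eq2 (λ ()) ,
    pqMat-den≢0 c2 q-1 , m11≢0 (cfMat (c3 ∷ T) 1ℤ) eq (λ ()) ,
    minusOne-nonzero c3 (pqMat-B-at-1 0) (alternating-tailAB ℓ)
    where
    c1 = poly X
    c2 = A g 0 -F poly oneP
    c3 = B g 0
    T = tailAB g ℓ
    q0 : pqMat (poly zeroP) 1ℤ ≡ quotMat 0ℤ
    q0 = pqMat-eval (poly zeroP) 1ℤ refl (eval-oneP 1ℤ)
    q1 : pqMat c1 1ℤ ≡ quotMat 1ℤ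
    q1 = pqMat-eval c1 1ℤ (eval-X 1ℤ) (eval-oneP 1ℤ)
    q-1 : pqMat c2 1ℤ ≡ quotMat -1ℤ
    q-1 = pqMat-minus-one (A g 0) 1ℤ (pqMat-A-at-1 0)
    identity₂ : ∀ m → quotMat -1ℤ ⊗ mk (- (1ℤ + m)) 1ℤ 1ℤ 0ℤ ≡ mk (+ 2 + m) -1ℤ (- (1ℤ + m)) 1ℤ
    identity₂ m = mk-cong (solve (m ∷ [])) (solve (m ∷ [])) (solve (m ∷ [])) (solve (m ∷ []))
    identity₁ : ∀ m → quotMat 1ℤ ⊗ mk (+ 2 + m) -1ℤ (- (1ℤ + m)) 1ℤ ≡ mk 1ℤ 0ℤ (+ 2 + m) -1ℤ
    identity₁ m = mk-cong (solve (m ∷ [])) (solve (m ∷ [])) (solve (m ∷ [])) (solve (m ∷ []))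
    eq2 : cfMat (c2 ∷ c3 ∷ T) 1ℤ ≡ mk (+ 2 + + n) -1ℤ (- (1ℤ + + n)) 1ℤ
    eq2 = trans (cong₂ _⊗_ q-1 eq) (identity₂ (+ n))
    eq1 : cfMat (c1 ∷ c2 ∷ c3 ∷ T) 1ℤ ≡ mk 1ℤ 0ℤ (+ 2 + + n) -1ℤ
    eq1 = trans (cong₂ _⊗_ q1 eq2) (identity₁ (+ n))

proposition7p2 : (g : Poly) (ℓ : ℕ) → 1 ≤ ℓ →
    Σ Frac (λ r → (contFrac (cfEntries g ℓ) ≡ just r) × (r ≈F lhsSum g ℓ))
proposition7p2 g (suc k) (s≤s z≤n) =
  cfPair (poly zeroP) quotients ,
  contFrac-defined (poly zeroP) quotients
    (cfNonzeroAt⇒CFDefined 1ℤ (poly zeroP) quotients (AtOne.cfEntries-nonzero g (suc k))) ,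
  vanishing⇒IsZeroP _ (λ n → Orbit.cross-difference≡0 g (+ suc n) k)
  where
  quotients = cfEntriesTail g (suc k)
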